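{- There is a constant $c'$ such that for every $n\ge 1$, $\chi(\mathbb{Z}_{5}^{n},1)\le c'\,(\sqrt{5})^{n}$.
   Context: $\mathbb{Z}_{5}=\mathbb{Z}/5\mathbb{Z}$. $\chi(\mathbb{Z}_{5}^{n},1)$ denotes the chromatic number of the graph with vertex set $\mathbb{Z}_{5}^{n}$ in which $x$ and $y$ are adjacent iff $\sum_{i=1}^{n}(x_{i}-y_{i})^{2}\equiv 1 \pmod 5$ (the squared $l_{2}$ distance taken modulo $5$ equals $1$); i.e. the minimal number of colours in a colouring with no two adjacent vertices of the same colour. -}

module Defs where

open import Data.Nat using (ℕ; zero; suc; _+_; _*_; _%_)
open import Data.Fin using (Fin; toℕ) renaming (zero to fzero; suc to fsuc)
open import Data.Product using (Σ; _×_)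
open import Relation.Binary.PropositionalEquality using (_≡_)
open import Relation.Nullary using (¬_)

Z5 : Set
Z5 = Fin 5

Z5^ : ℕ → Set
Z5^ n = Fin n → Z5

sumFin : (n : ℕ) → (Fin n → ℕ) → ℕ
sumFin zero    f = 0
sumFin (suc n) f = f fzero + sumFin n (λ i → f (fsuc i))

diff5 : Z5 → Z5 → ℕ
diff5 a b = (toℕ a + 5 Data.Nat.∸ toℕ b) % 5

-- squared l2 distance (as a natural number whose residue mod 5 is the
-- squared distance in Z_5)
sqDist : (n : ℕ) → Z5^ n → Z5^ n → ℕ
sqDist n x y = sumFin n (λ i → diff5 (x i) (y i) * diff5 (x i) (y i))

Adj : (n : ℕ) → Z5^ n → Z5^ n → Set
Adj n x y = sqDist n x y % 5 ≡ 1

ProperColouring : (n k : ℕ) → (Z5^ n → Fin k) → Set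
ProperColouring n k col = ∀ x y → Adj n x y → ¬ (col x ≡ col y)

-- χ(Z_5^n,1) ≤ k  iff a proper k-colouring exists
Colourable : (n k : ℕ) → Set
Colourable n k = Σ (Z5^ n → Fin k) (ProperColouring n k)

module Submission where

-- Call a colouring *isotropic* if any two points of the same colour have
-- squared distance ≡ 0 (mod 5); such a colouring is proper for the distance-1
-- graph.  In Z₅² the map (a , b) ↦ a + 2b is an isotropic 5-colouring: equal
-- colours give differences (d , e) with d ≡ −2e, and since 2² ≡ −1 (mod 5)
-- this forces d² + e² ≡ 0.  Squared distance is additive over a splitting of
-- coordinates, so the product of isotropic colourings of Z₅ᵐ and Z₅ⁿ is an
-- isotropic colouring of Z₅ᵐ⁺ⁿ.  Iterating the planar colouring (with the
-- identity colouring for a leftover coordinate) colours Z₅ⁿ with K n colours,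
-- where K n = 5^⌈n/2⌉, hence K n ² ≤ 5 · 5ⁿ.

open import Defs
open import Data.Nat using (ℕ; zero; suc; _+_; _*_; _∸_; _^_; _%_; _≤_; NonZero; z≤n; s≤s)
open import Data.Nat.Properties
open import Data.Nat.DivMod using (%-distribˡ-+; %-distribˡ-*; m%n%n≡m%n; [m+n]%n≡m%n; [m+kn]%n≡m%n; m*n%n≡0; _mod_)
open import Data.Nat.Divisibility using (_∣_; ∣m∣n⇒∣m+n; ∣m+n∣m⇒∣n; ∣m⇒∣m*n; m∣m*n; _∣0; m%n≡0⇒n∣m; n∣m⇒m%n≡0)
open import Data.Nat.Tactic.RingSolver using (solve-∀)
open import Data.Fin using (Fin; toℕ; combine; _↑ˡ_; _↑ʳ_) renaming (zero to fzero; suc to fsuc)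
open import Data.Fin.Patterns using (0F; 1F)
open import Data.Fin.Properties using (toℕ<n; toℕ-fromℕ<; combine-injective)
open import Data.Product using (Σ; _×_; _,_)
open import Function using (_∘_)
open import Relation.Binary.PropositionalEquality

%-cong-+ : ∀ d .{{_ : NonZero d}} (x x′ y y′ : ℕ) →
           x % d ≡ x′ % d → y % d ≡ y′ % d → (x + y) % d ≡ (x′ + y′) % d
%-cong-+ d x x′ y y′ x≡x′ y≡y′ = begin
  (x + y) % d             ≡⟨ %-distribˡ-+ x y d ⟩
  (x % d + y % d) % d     ≡⟨ cong₂ (λ u v → (u + v) % d) x≡x′ y≡y′ ⟩
  (x′ % d + y′ % d) % d   ≡⟨ %-distribˡ-+ x′ y′ d ⟨
  (x′ + y′) % d           ∎
  where open ≡-Reasoning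

%-cong-*ˡ : ∀ d .{{_ : NonZero d}} k (y y′ : ℕ) →
            y % d ≡ y′ % d → (k * y) % d ≡ (k * y′) % d
%-cong-*ˡ d k y y′ y≡y′ = begin
  (k * y) % d             ≡⟨ %-distribˡ-* k y d ⟩
  (k % d * (y % d)) % d   ≡⟨ cong (λ v → (k % d * v) % d) y≡y′ ⟩
  (k % d * (y′ % d)) % d  ≡⟨ %-distribˡ-* k y′ d ⟨
  (k * y′) % d            ∎
  where open ≡-Reasoning

-- diff5 a b represents a − b, which is a + 4b modulo 5.
diff5-congruent : ∀ a b → diff5 a b % 5 ≡ (toℕ a + 4 * toℕ b) % 5
diff5-congruent a b = begin
  diff5 a b % 5               ≡⟨ m%n%n≡m%n (toℕ a + 5 ∸ toℕ b) 5 ⟩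
  (toℕ a + 5 ∸ toℕ b) % 5     ≡⟨ [m+kn]%n≡m%n (toℕ a + 5 ∸ toℕ b) (toℕ b) 5 ⟨
  (toℕ a + 5 ∸ toℕ b + toℕ b * 5) % 5 ≡⟨ cong (_% 5) shift ⟩
  (toℕ a + 4 * toℕ b + 5) % 5 ≡⟨ [m+n]%n≡m%n (toℕ a + 4 * toℕ b) 5 ⟩
  (toℕ a + 4 * toℕ b) % 5     ∎
  where
  open ≡-Reasoning
  b≤a+5 : toℕ b ≤ toℕ a + 5
  b≤a+5 = ≤-trans (<⇒≤ (toℕ<n b)) (m≤n+m 5 (toℕ a))
  -- adding 5b = b + 4b undoes the truncated subtraction
  shift : toℕ a + 5 ∸ toℕ b + toℕ b * 5 ≡ toℕ a + 4 * toℕ b + 5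
  shift = begin
    toℕ a + 5 ∸ toℕ b + toℕ b * 5           ≡⟨ cong (toℕ a + 5 ∸ toℕ b +_) (*-comm (toℕ b) 5) ⟩
    toℕ a + 5 ∸ toℕ b + (toℕ b + 4 * toℕ b) ≡⟨ +-assoc (toℕ a + 5 ∸ toℕ b) (toℕ b) (4 * toℕ b) ⟨
    toℕ a + 5 ∸ toℕ b + toℕ b + 4 * toℕ b   ≡⟨ cong (_+ 4 * toℕ b) (m∸n+n≡m b≤a+5) ⟩
    toℕ a + 5 + 4 * toℕ b                   ≡⟨ +-assoc (toℕ a) 5 (4 * toℕ b) ⟩
    toℕ a + (5 + 4 * toℕ b)                 ≡⟨ cong (toℕ a +_) (+-comm 5 (4 * toℕ b)) ⟩
    toℕ a + (4 * toℕ b + 5)                 ≡⟨ +-assoc (toℕ a) (4 * toℕ b) 5 ⟨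
    toℕ a + 4 * toℕ b + 5                   ∎

diff5-self : ∀ a → diff5 a a ≡ 0
diff5-self a = cong (_% 5) (m+n∸m≡n (toℕ a) 5)

-- The line d + 2e ≡ 0 is isotropic: (d + 2e)(d + 3e) = d² + e² + 5(de + e²),
-- which reflects 2² ≡ −1 (mod 5).
isotropic-line : ∀ d e → 5 ∣ d + 2 * e → 5 ∣ d * d + e * e
isotropic-line d e 5∣d+2e = ∣m+n∣m⇒∣n 5∣sum (m∣m*n (d * e + e * e))
  where
  factor : ∀ d e → (d + 2 * e) * (d + 3 * e) ≡ 5 * (d * e + e * e) + (d * d + e * e)
  factor = solve-∀
  5∣sum : 5 ∣ 5 * (d * e + e * e) + (d * d + e * e)
  5∣sum = subst (5 ∣_) (factor d e) (∣m⇒∣m*n (d + 3 * e) 5∣d+2e)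

Isotropic : (n k : ℕ) → (Z5^ n → Fin k) → Set
Isotropic n k col = ∀ x y → col x ≡ col y → 5 ∣ sqDist n x y

isotropic⇒proper : ∀ {n k} (col : Z5^ n → Fin k) → Isotropic n k col → ProperColouring n k col
isotropic⇒proper col iso x y adj sameColour
  with () ← trans (sym (n∣m⇒m%n≡0 (sqDist _ x y) 5 (iso x y sameColour))) adj

pairColour : Z5 → Z5 → Z5
pairColour a b = (toℕ a + 2 * toℕ b) mod 5

-- Equal planar colours make the coordinate differences satisfy d + 2e ≡ 0:
-- d + 2e ≡ (a₀ + 2a₁) + 4(b₀ + 2b₁) ≡ 5(b₀ + 2b₁) ≡ 0.
pairColour-line : ∀ a₀ a₁ b₀ b₁ → pairColour a₀ a₁ ≡ pairColour b₀ b₁ →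
                  5 ∣ diff5 a₀ b₀ + 2 * diff5 a₁ b₁
pairColour-line a₀ a₁ b₀ b₁ sameColour = m%n≡0⇒n∣m _ 5 (begin
  (diff5 a₀ b₀ + 2 * diff5 a₁ b₁) % 5
    ≡⟨ %-cong-+ 5 (diff5 a₀ b₀) (x₀ + 4 * y₀) (2 * diff5 a₁ b₁) (2 * (x₁ + 4 * y₁))
         (diff5-congruent a₀ b₀) (%-cong-*ˡ 5 2 (diff5 a₁ b₁) (x₁ + 4 * y₁) (diff5-congruent a₁ b₁)) ⟩
  (x₀ + 4 * y₀ + 2 * (x₁ + 4 * y₁)) % 5 ≡⟨ cong (_% 5) (regroup x₀ x₁ y₀ y₁) ⟩
  ((x₀ + 2 * x₁) + 4 * (y₀ + 2 * y₁)) % 5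
    ≡⟨ %-cong-+ 5 (x₀ + 2 * x₁) (y₀ + 2 * y₁) (4 * (y₀ + 2 * y₁)) _ sameResidue refl ⟩
  ((y₀ + 2 * y₁) + 4 * (y₀ + 2 * y₁)) % 5 ≡⟨ cong (_% 5) (five-copies (y₀ + 2 * y₁)) ⟩
  (y₀ + 2 * y₁) * 5 % 5                   ≡⟨ m*n%n≡0 (y₀ + 2 * y₁) 5 ⟩
  0                                       ∎)
  where
  open ≡-Reasoning
  x₀ x₁ y₀ y₁ : ℕ
  x₀ = toℕ a₀ ; x₁ = toℕ a₁ ; y₀ = toℕ b₀ ; y₁ = toℕ b₁
  regroup : ∀ x₀ x₁ y₀ y₁ → x₀ + 4 * y₀ + 2 * (x₁ + 4 * y₁) ≡ (x₀ + 2 * x₁) + 4 * (y₀ + 2 * y₁)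
  regroup = solve-∀
  five-copies : ∀ z → z + 4 * z ≡ z * 5
  five-copies = solve-∀
  sameResidue : (x₀ + 2 * x₁) % 5 ≡ (y₀ + 2 * y₁) % 5
  sameResidue = trans (sym (toℕ-fromℕ< _)) (trans (cong toℕ sameColour) (toℕ-fromℕ< _))

pointColouring : Z5^ 0 → Fin 1
pointColouring _ = fzero

pointColouring-isotropic : Isotropic 0 1 pointColouring
pointColouring-isotropic _ _ _ = 5 ∣0

lineColouring : Z5^ 1 → Fin 5
lineColouring x = x 0F

lineColouring-isotropic : Isotropic 1 5 lineColouring
lineColouring-isotropic x y sameColour
  rewrite sameColour | diff5-self (y 0F) = 5 ∣0

planeColouring : Z5^ 2 → Fin 5
planeColouring x = pairColour (x 0F) (x 1F)

planeColouring-isotropic : Isotropic 2 5 planeColouring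
planeColouring-isotropic x y sameColour
  rewrite +-identityʳ (diff5 (x 1F) (y 1F) * diff5 (x 1F) (y 1F))
  = isotropic-line (diff5 (x 0F) (y 0F)) (diff5 (x 1F) (y 1F)) (pairColour-line (x 0F) (x 1F) (y 0F) (y 1F) sameColour)

sumFin-split : ∀ m n (f : Fin (m + n) → ℕ) →
               sumFin (m + n) f ≡ sumFin m (f ∘ (_↑ˡ n)) + sumFin n (f ∘ (m ↑ʳ_))
sumFin-split zero    n f = refl
sumFin-split (suc m) n f = begin
  f fzero + sumFin (m + n) (f ∘ fsuc)
    ≡⟨ cong (f fzero +_) (sumFin-split m n (f ∘ fsuc)) ⟩
  f fzero + (sumFin m (f ∘ fsuc ∘ (_↑ˡ n)) + sumFin n (f ∘ fsuc ∘ (m ↑ʳ_)))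
    ≡⟨ +-assoc (f fzero) _ _ ⟨
  f fzero + sumFin m (f ∘ fsuc ∘ (_↑ˡ n)) + sumFin n (f ∘ fsuc ∘ (m ↑ʳ_)) ∎
  where open ≡-Reasoning

front : ∀ m n → Z5^ (m + n) → Z5^ m
front m n x = x ∘ (_↑ˡ n)

back : ∀ m n → Z5^ (m + n) → Z5^ n
back m n x = x ∘ (m ↑ʳ_)

productColouring : ∀ m n {k l} → (Z5^ m → Fin k) → (Z5^ n → Fin l) → Z5^ (m + n) → Fin (k * l)
productColouring m n col₁ col₂ x = combine (col₁ (front m n x)) (col₂ (back m n x))

-- Squared distances of the blocks add up, so the product of isotropic
-- colourings is isotropic.
product-isotropic : ∀ m n {k l} (col₁ : Z5^ m → Fin k) (col₂ : Z5^ n → Fin l) →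
                    Isotropic m k col₁ → Isotropic n l col₂ →
                    Isotropic (m + n) (k * l) (productColouring m n col₁ col₂)
product-isotropic m n col₁ col₂ iso₁ iso₂ x y sameColour
  with same₁ , same₂ ← combine-injective _ _ _ _ sameColour
  rewrite sumFin-split m n (λ i → diff5 (x i) (y i) * diff5 (x i) (y i))
  = ∣m∣n⇒∣m+n (iso₁ (front m n x) (front m n y) same₁) (iso₂ (back m n x) (back m n y) same₂)

-- Number of colours used in dimension n: 5 ^ ⌈n / 2⌉.
K : ℕ → ℕ
K zero          = 1
K (suc zero)    = 5
K (suc (suc n)) = 5 * K n

colouring : ∀ n → Z5^ n → Fin (K n)
colouring zero          = pointColouring
colouring (suc zero)    = lineColouring
colouring (suc (suc n)) = productColouring 2 n planeColouring (colouring n)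

colouring-isotropic : ∀ n → Isotropic n (K n) (colouring n)
colouring-isotropic zero          = pointColouring-isotropic
colouring-isotropic (suc zero)    = lineColouring-isotropic
colouring-isotropic (suc (suc n)) =
  product-isotropic 2 n planeColouring (colouring n) planeColouring-isotropic (colouring-isotropic n)

K-squared-bound : ∀ n → K n * K n ≤ 5 * 5 ^ n
K-squared-bound zero          = s≤s z≤n
K-squared-bound (suc zero)    = ≤-refl
K-squared-bound (suc (suc n)) = begin
  5 * K n * (5 * K n) ≡⟨ square (K n) ⟩
  25 * (K n * K n)    ≤⟨ *-monoʳ-≤ 25 (K-squared-bound n) ⟩
  25 * (5 * 5 ^ n)    ≡⟨ *-assoc 5 5 (5 * 5 ^ n) ⟩
  5 * 5 ^ suc (suc n) ∎
  where
  open ≤-Reasoning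
  square : ∀ k → 5 * k * (5 * k) ≡ 25 * (k * k)
  square = solve-∀

mainTheorem13 : Σ ℕ λ c → (n : ℕ) → 1 ≤ n →
    Σ ℕ λ k → Colourable n k × (k * k ≤ c * c * 5 ^ n)
mainTheorem13 = 3 , λ n _ →
  K n ,
  (colouring n , isotropic⇒proper (colouring n) (colouring-isotropic n)) ,
  ≤-trans (K-squared-bound n) (*-monoˡ-≤ (5 ^ n) 5≤9)
  where
  5≤9 : 5 ≤ 3 * 3
  5≤9 = s≤s (s≤s (s≤s (s≤s (s≤s z≤n))))
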